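{- Let $N\ge 1$ be an integer. The smallest integer $h\ge1$ such that there exists a lattice data structure of height $h$ holding exactly $N$ proper keys is $$h=\left\lfloor \frac{1+\sqrt{8N-7}}{2}\right\rfloor=\left\lceil \frac{ -1+\sqrt{8N+1}}{2}\right\rceil .$$
   Context: Fix an integer $h\ge 1$. The diagram of height $h$ is the set of cells $(r,c)$ of positive integers with $r+c\le h+4$; $r$ is the row (numbered bottom to top), $c$ the column (numbered left to right). For $1\le k\le h+3$, diagonal $k$ is the set of cells with $r+c=k+1$; its cells are numbered from its head $(k,1)$ to its tail $(1,k)$, the $j$-th cell being $(k+1-j,j)$. A lattice data structure (LDS) of height $h$ is an assignment of an entry from $\{0,\infty\}\cup\mathbb{Z}_{>0}$ to every cell such that: (1) every cell of row $1$ and of column $1$ contains $0$; (2) every cell of diagonal $h+3$ other than its head and tail contains $\infty$; (3) for some $m$ with $0\le m\le h-1$, exactly the cells $(h+3-j,j)$ of diagonal $h+2$ with $h+2-m\le j\le h+1$ contain $\infty$; (4) every remaining cell contains a positive integer, these (the proper keys) being pairwise distinct; (5) the proper keys in each row, column and diagonal are strictly increasing from left to right, bottom to top, and head to tail, respectively. -}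

module Defs where

open import Data.Nat using (ℕ; zero; suc; _+_; _*_; _∸_; _≤_; _<_)
open import Data.List using (List; []; _∷_; upTo; concatMap; map)
open import Data.Product using (Σ; _×_; _,_)
open import Data.Sum using (_⊎_)
open import Relation.Binary.PropositionalEquality using (_≡_)

-- Entries: 0, ∞, or an integer.  Proper keys are the positive integers.
data Entry : Set where
  zer : Entry
  ∞   : Entry
  key : ℕ → Entry

-- An assignment gives an entry to every pair (r , c) (row r, column c);
-- only the cells of the diagram matter.
Assignment : Set
Assignment = ℕ → ℕ → Entry

InDiagram : ℕ → ℕ → ℕ → Set
InDiagram h r c = 1 ≤ r × 1 ≤ c × r + c ≤ h + 4

-- The cells required by (4) to hold proper keys, given h and the parameter m of (3):
-- not in row 1 / column 1, and either strictly below diagonal h+2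
-- (r + c ≤ h + 2), or on diagonal h+2 (r + c = h + 3) at position j = c < h + 2 - m.
KeyCell : ℕ → ℕ → ℕ → ℕ → Set
KeyCell h m r c = 2 ≤ r × 2 ≤ c × (r + c ≤ h + 2 ⊎ (r + c ≡ h + 3 × c + m < h + 2))

record IsLDS (h : ℕ) (f : Assignment) : Set where
  field
    border : ∀ r c → InDiagram h r c → (r ≡ 1 ⊎ c ≡ 1) → f r c ≡ zer
    diagInf : ∀ r c → 2 ≤ r → 2 ≤ c → r + c ≡ h + 4 → f r c ≡ ∞
    -- (3) the parameter m, 0 ≤ m ≤ h - 1, and the cells (h+3-j , j) of diagonal h+2 with
    --     h+2-m ≤ j ≤ h+1 contain ∞ (the other cells of that diagonal are
    --     forced by (1) and (4) to hold 0 or proper keys, so "exactly" holds)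
    m      : ℕ
    m≤h-1  : m + 1 ≤ h
    partInf : ∀ r c → 1 ≤ r → r + c ≡ h + 3 → h + 2 ≤ c + m → c ≤ h + 1 → f r c ≡ ∞
    keys   : ∀ r c → KeyCell h m r c → Σ ℕ (λ k → 1 ≤ k × f r c ≡ key k)
    distinct : ∀ r c r' c' → KeyCell h m r c → KeyCell h m r' c' →
               f r c ≡ f r' c' → r ≡ r' × c ≡ c'
    rowInc  : ∀ r c c' a b → KeyCell h m r c → KeyCell h m r c' →
              f r c ≡ key a → f r c' ≡ key b → c < c' → a < b
    colInc  : ∀ r r' c a b → KeyCell h m r c → KeyCell h m r' c →
              f r c ≡ key a → f r' c ≡ key b → r < r' → a < b
    diagInc : ∀ r c r' c' a b → KeyCell h m r c → KeyCell h m r' c' →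
              r + c ≡ r' + c' → f r c ≡ key a → f r' c' ≡ key b → c < c' → a < b

cells : ℕ → List (ℕ × ℕ)
cells h = concatMap (λ i → map (λ j → (suc i , suc j)) (upTo (h + 3 ∸ i))) (upTo (h + 3))

isProperKey : Entry → ℕ
isProperKey (key (suc _)) = 1
isProperKey _             = 0

countKeys : Assignment → List (ℕ × ℕ) → ℕ
countKeys f []            = 0
countKeys f ((r , c) ∷ l) = isProperKey (f r c) + countKeys f l

numKeys : ℕ → Assignment → ℕ
numKeys h f = countKeys f (cells h)

HasLDS : ℕ → ℕ → Set
HasLDS h N = Σ Assignment (λ f → IsLDS h f × numKeys h f ≡ N)

-- The proper keys of an LDS of height h = q + 1 with parameter m occupy exactly the cells
-- (r , c) with r , c ≥ 2 and r + c ≤ h + 2, which are T(q) = q(q+1)/2 in number, together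
-- with the h - m cells of diagonal h + 2 that (3) leaves to keys. So an LDS of height h holds
-- between T(h-1) + 1 and T(h) keys, and every such number is attained by labelling the key
-- cells by diagonal and then by column. The least height for N keys is therefore the least h
-- with N ≤ T(h), i.e. with 8N + 1 ≤ (2h + 1)², and ⌊(1 + ⌊√(8N-7)⌋)/2⌋ is that h because
-- (2h - 1)² = 8T(h-1) + 1 ≤ 8N - 7 < 8T(h) + 1 = (2h + 1)².
module Submission where

open import Defs
open import Data.Nat
  using (ℕ; zero; suc; _+_; _*_; _∸_; _≤_; _<_; _/_; _%_; z≤n; s≤s; s≤s⁻¹; _≤?_; _<?_; _≟_; NonZero)
open import Data.Nat.Properties
open import Algebra.Properties.CommutativeSemigroup +-commutativeSemigroup
  using () renaming (interchange to +-interchange)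
open import Data.Nat.DivMod using (m≡m%n+[m/n]*n; m/n*n≤m; m%n<n; m<n⇒m%n≡m; [m+kn]%n≡m%n)
open import Data.Nat.Tactic.RingSolver using (solve-∀)
open import Data.List using (List; []; _∷_; _++_; map; applyUpTo; concatMap)
open import Function using (id; _∘_)
open import Data.Product using (_×_; _,_; ∃-syntax; proj₁; proj₂)
import Data.Product
open import Relation.Binary.PropositionalEquality
  using (_≡_; refl; sym; trans; cong; cong₂; subst; subst₂; module ≡-Reasoning)
open import Data.Sum using (_⊎_; inj₁; inj₂; [_,_])
import Data.Sum
open import Data.Bool using (if_then_else_)
open import Relation.Nullary.Decidable using (_×-dec_; _⊎-dec_; does; dec-true; dec-false)
open import Relation.Nullary using (¬_; Dec; yes; no; contradiction)

+≤⇒≤∸ : ∀ {i j n} → i + j ≤ n → j ≤ n ∸ i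
+≤⇒≤∸ {i} {j} {n} le = m+n≤o⇒m≤o∸n j (subst (_≤ n) (+-comm i j) le)

≤∸⇒+≤ : ∀ {i j n} → 1 ≤ j → j ≤ n ∸ i → i + j ≤ n
≤∸⇒+≤ {i} {j} {n} 1≤j le = subst (_≤ n) (+-comm j i) (m≤o∸n⇒m+n≤o j i≤n le)
  where
  i≤n : i ≤ n
  i≤n = <⇒≤ (m∸n≢0⇒n<m (m<n⇒n≢0 (≤-trans 1≤j le)))

∸-monoˡ-<′ : ∀ {m n o} → m < o → n < o → m ∸ n < o ∸ n
∸-monoˡ-<′ {m} {n} {o} m<o n<o with n ≤? m
... | yes n≤m = ∸-monoˡ-< m<o n≤m
... | no  n≰m = subst (_< o ∸ n) (sym (m≤n⇒m∸n≡0 (<⇒≤ (≰⇒> n≰m)))) (m<n⇒0<n∸m n<o)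

≤+1⇒≤⊎≡+1 : ∀ {n k} → n ≤ k + 1 → n ≤ k ⊎ n ≡ k + 1
≤+1⇒≤⊎≡+1 {n} {k} le with m≤n⇒m<n∨m≡n le
... | inj₁ n<k+1 = inj₁ (s≤s⁻¹ (subst (n <_) (+-comm k 1) n<k+1))
... | inj₂ n≡k+1 = inj₂ n≡k+1

remainder-quotient-injective : ∀ {K a a′ c c′} .{{_ : NonZero K}} → c < K → c′ < K →
  c + a * K ≡ c′ + a′ * K → c ≡ c′ × a ≡ a′
remainder-quotient-injective {K} {a} {a′} {c} {c′} c<K c′<K eq =
  c≡c′ , *-cancelʳ-≡ a a′ K aK≡a′K
  where
  c≡c′ : c ≡ c′
  c≡c′ = begin
    c                  ≡⟨ m<n⇒m%n≡m c<K ⟨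
    c % K              ≡⟨ [m+kn]%n≡m%n c a K ⟨
    (c + a * K) % K    ≡⟨ cong (_% K) eq ⟩
    (c′ + a′ * K) % K  ≡⟨ [m+kn]%n≡m%n c′ a′ K ⟩
    c′ % K             ≡⟨ m<n⇒m%n≡m c′<K ⟩
    c′                 ∎
    where open ≡-Reasoning
  aK≡a′K : a * K ≡ a′ * K
  aK≡a′K = +-cancelˡ-≡ c _ _ (trans eq (cong (_+ a′ * K) (sym c≡c′)))

8[1+n]∸7≡8n+1 : ∀ n → 8 * suc n ∸ 7 ≡ 8 * n + 1
8[1+n]∸7≡8n+1 n = trans (cong (_∸ 7) (expand n)) (m+n∸n≡m (8 * n + 1) 7)
  where
  expand : ∀ n → 8 * suc n ≡ 8 * n + 1 + 7
  expand = solve-∀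

-- Triangular numbers

triangle : ℕ → ℕ
triangle zero    = 0
triangle (suc n) = suc n + triangle n

odd-square≡8*triangle+1 : ∀ k → (2 * k + 1) * (2 * k + 1) ≡ 8 * triangle k + 1
odd-square≡8*triangle+1 zero    = refl
odd-square≡8*triangle+1 (suc k) = begin
  (2 * suc k + 1) * (2 * suc k + 1)      ≡⟨ expand k ⟩
  (2 * k + 1) * (2 * k + 1) + 8 * suc k  ≡⟨ cong (_+ 8 * suc k) (odd-square≡8*triangle+1 k) ⟩
  8 * triangle k + 1 + 8 * suc k         ≡⟨ regroup k (triangle k) ⟩
  8 * (suc k + triangle k) + 1           ∎
  where
  open ≡-Reasoning
  expand : ∀ k → (2 * suc k + 1) * (2 * suc k + 1) ≡ (2 * k + 1) * (2 * k + 1) + 8 * suc k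
  expand = solve-∀
  regroup : ∀ k t → 8 * t + 1 + 8 * suc k ≡ 8 * (suc k + t) + 1
  regroup = solve-∀

triangle-mono-≤ : ∀ {m n} → m ≤ n → triangle m ≤ triangle n
triangle-mono-≤ {zero}          _         = z≤n
triangle-mono-≤ {suc m} {suc n} (s≤s m≤n) = +-mono-≤ (s≤s m≤n) (triangle-mono-≤ m≤n)

triangle-cancel-< : ∀ {m n} → triangle m < triangle n → m < n
triangle-cancel-< tm<tn = ≰⇒> (λ n≤m → <⇒≱ tm<tn (triangle-mono-≤ n≤m))

≤triangle⇒≤odd-square : ∀ {n k} → n ≤ triangle k → 8 * n + 1 ≤ (2 * k + 1) * (2 * k + 1)
≤triangle⇒≤odd-square {n} {k} n≤t =
  subst (8 * n + 1 ≤_) (sym (odd-square≡8*triangle+1 k)) (+-monoˡ-≤ 1 (*-monoʳ-≤ 8 n≤t))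

≤odd-square⇒≤triangle : ∀ {n k} → 8 * n + 1 ≤ (2 * k + 1) * (2 * k + 1) → n ≤ triangle k
≤odd-square⇒≤triangle {n} {k} le =
  *-cancelˡ-≤ 8 (+-cancelʳ-≤ 1 _ _ (subst (8 * n + 1 ≤_) (odd-square≡8*triangle+1 k) le))

odd-square≤⇒triangle≤ : ∀ {n k} → (2 * k + 1) * (2 * k + 1) ≤ 8 * n + 1 → triangle k ≤ n
odd-square≤⇒triangle≤ {n} {k} le =
  *-cancelˡ-≤ 8 (+-cancelʳ-≤ 1 _ _ (subst (_≤ 8 * n + 1) (odd-square≡8*triangle+1 k) le))

<odd-square⇒<triangle : ∀ {n k} → 8 * n + 1 < (2 * k + 1) * (2 * k + 1) → n < triangle k
<odd-square⇒<triangle {n} {k} lt =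
  *-cancelˡ-< 8 _ _ (+-cancelʳ-< 1 _ _ (subst (8 * n + 1 <_) (odd-square≡8*triangle+1 k) lt))

isqrt-triangle-bracket : ∀ {n s} → s * s ≤ 8 * n + 1 → 8 * n + 1 < suc s * suc s →
  ∃[ p ] (1 + s) / 2 ≡ suc p × triangle p ≤ n × n < triangle (suc p)
isqrt-triangle-bracket {n} {s} lo hi = bracket (m/n*n≤m (1 + s) 2) half-upper
  where
  half-upper : 1 + s ≤ 1 + (1 + s) / 2 * 2
  half-upper = begin
    1 + s                          ≡⟨ m≡m%n+[m/n]*n (1 + s) 2 ⟩
    (1 + s) % 2 + (1 + s) / 2 * 2  ≤⟨ +-monoˡ-≤ _ (≤-pred (m%n<n (1 + s) 2)) ⟩
    1 + (1 + s) / 2 * 2            ∎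
    where open ≤-Reasoning
  bracket : ∀ {h} → h * 2 ≤ 1 + s → 1 + s ≤ 1 + h * 2 →
    ∃[ p ] h ≡ suc p × triangle p ≤ n × n < triangle (suc p)
  bracket {zero} _ (s≤s s≤0) =
    contradiction (m+n≤o⇒n≤o (8 * n) (≤-pred (<-≤-trans hi (*-mono-≤ (s≤s s≤0) (s≤s s≤0)))))
                  λ ()
  bracket {suc p} 2h≤1+s 1+s≤1+2h =
    p , refl ,
    odd-square≤⇒triangle≤ {k = p} (≤-trans (*-mono-≤ 2p+1≤s 2p+1≤s) lo) ,
    <odd-square⇒<triangle {k = suc p} (<-≤-trans hi (*-mono-≤ 1+s≤2p+3 1+s≤2p+3))
    where
    2p+1≤s : 2 * p + 1 ≤ s
    2p+1≤s = subst (_≤ s) (lemma p) (≤-pred 2h≤1+s)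
      where lemma : ∀ p → suc (p * 2) ≡ 2 * p + 1
            lemma = solve-∀
    1+s≤2p+3 : suc s ≤ 2 * suc p + 1
    1+s≤2p+3 = subst (suc s ≤_) (lemma p) 1+s≤1+2h
      where lemma : ∀ p → 1 + suc p * 2 ≡ 2 * suc p + 1
            lemma = solve-∀

∑ : ℕ → (ℕ → ℕ) → ℕ
∑ zero    g = 0
∑ (suc n) g = g 0 + ∑ n (λ j → g (suc j))

∑-cong : ∀ n {g g′ : ℕ → ℕ} → (∀ {j} → j < n → g j ≡ g′ j) → ∑ n g ≡ ∑ n g′
∑-cong zero    eq = refl
∑-cong (suc n) eq = cong₂ _+_ (eq (s≤s z≤n)) (∑-cong n (λ j<n → eq (s≤s j<n)))

∑-zero : ∀ n → ∑ n (λ _ → 0) ≡ 0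
∑-zero zero    = refl
∑-zero (suc n) = ∑-zero n

∑-distrib-+ : ∀ n (g g′ : ℕ → ℕ) → ∑ n (λ j → g j + g′ j) ≡ ∑ n g + ∑ n g′
∑-distrib-+ zero    g g′ = refl
∑-distrib-+ (suc n) g g′ =
  trans (cong (g 0 + g′ 0 +_) (∑-distrib-+ n _ _)) (+-interchange (g 0) (g′ 0) _ _)

∑-∸≡triangle : ∀ {q n} → q ≤ n → ∑ n (q ∸_) ≡ triangle q
∑-∸≡triangle {zero}  {n}     _         = trans (∑-cong n (λ {j} _ → 0∸n≡0 j)) (∑-zero n)
∑-∸≡triangle {suc q} {suc n} (s≤s q≤n) = cong (suc q +_) (∑-∸≡triangle q≤n)

𝟙 : ∀ {P : Set} → Dec P → ℕ
𝟙 (yes _) = 1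
𝟙 (no _)  = 0

𝟙-yes : ∀ {P : Set} → P → (p? : Dec P) → 𝟙 p? ≡ 1
𝟙-yes p (yes _) = refl
𝟙-yes p (no ¬p) = contradiction p ¬p

𝟙-no : ∀ {P : Set} → ¬ P → (p? : Dec P) → 𝟙 p? ≡ 0
𝟙-no ¬p (yes p) = contradiction p ¬p
𝟙-no ¬p (no _)  = refl

∑-𝟙-interval : ∀ {P : ℕ → Set} (P? : ∀ j → Dec (P j)) n {a b} → a ≤ b → b ≤ n →
  (∀ {j} → P j → a ≤ j × j < b) → (∀ {j} → a ≤ j → j < b → P j) →
  ∑ n (λ j → 𝟙 (P? j)) ≡ b ∸ a
∑-𝟙-interval P? zero    z≤n z≤n _ _ = refl
∑-𝟙-interval {P} P? (suc n) {zero} {zero} z≤n z≤n inside _ =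
  cong₂ _+_ (𝟙-no never (P? 0))
            (∑-𝟙-interval (λ j → P? (suc j)) n z≤n z≤n (λ p → contradiction p never) λ _ ())
  where
  never : ∀ {j} → ¬ P j
  never p with () ← proj₂ (inside p)
∑-𝟙-interval P? (suc n) {zero} {suc b} z≤n (s≤s b≤n) inside fill =
  cong₂ _+_ (𝟙-yes (fill z≤n (s≤s z≤n)) (P? 0))
            (∑-𝟙-interval (λ j → P? (suc j)) n z≤n b≤n
                          (λ p → z≤n , s≤s⁻¹ (proj₂ (inside p)))
                          (λ _ j<b → fill z≤n (s≤s j<b)))
∑-𝟙-interval P? (suc n) {suc a} {suc b} (s≤s a≤b) (s≤s b≤n) inside fill =
  cong₂ _+_ (𝟙-no (λ p → contradiction (proj₁ (inside p)) λ ()) (P? 0))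
            (∑-𝟙-interval (λ j → P? (suc j)) n a≤b b≤n
                          (λ p → Data.Product.map s≤s⁻¹ s≤s⁻¹ (inside p))
                          (λ a≤j j<b → fill (s≤s a≤j) (s≤s j<b)))

-- Counting the key cells of a diagram

countKeys-++ : ∀ f xs ys → countKeys f (xs ++ ys) ≡ countKeys f xs + countKeys f ys
countKeys-++ f []             ys = refl
countKeys-++ f ((r , c) ∷ xs) ys =
  trans (cong (isProperKey (f r c) +_) (countKeys-++ f xs ys)) (sym (+-assoc (isProperKey (f r c)) _ _))

countKeys-row : ∀ f r (col : ℕ → ℕ) n →
  countKeys f (map (λ j → (r , suc j)) (applyUpTo col n))
    ≡ ∑ n (λ j → isProperKey (f r (suc (col j))))
countKeys-row f r col zero    = refl
countKeys-row f r col (suc n) = cong (isProperKey (f r (suc (col 0))) +_) (countKeys-row f r (col ∘ suc) n)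

countKeys-rows : ∀ f (row : ℕ → List (ℕ × ℕ)) (idx : ℕ → ℕ) n →
  countKeys f (concatMap row (applyUpTo idx n)) ≡ ∑ n (λ i → countKeys f (row (idx i)))
countKeys-rows f row idx zero    = refl
countKeys-rows f row idx (suc n) =
  trans (countKeys-++ f (row (idx 0)) _)
        (cong (countKeys f (row (idx 0)) +_) (countKeys-rows f row (idx ∘ suc) n))

numKeys≡∑∑ : ∀ h f →
  numKeys h f ≡ ∑ (h + 3) (λ i → ∑ (h + 3 ∸ i) (λ j → isProperKey (f (suc i) (suc j))))
numKeys≡∑∑ h f = trans (countKeys-rows f _ id (h + 3))
  (∑-cong (h + 3) (λ {i} _ → countKeys-row f (suc i) id (h + 3 ∸ i)))

keyCell? : ∀ h m r c → Dec (KeyCell h m r c)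
keyCell? h m r c =
  2 ≤? r ×-dec 2 ≤? c ×-dec (r + c ≤? h + 2 ⊎-dec (r + c ≟ h + 3 ×-dec c + m <? h + 2))

-- The key cells (i + 2 , j + 1) of row i + 2 of the diagram of height q + 1 (for j ≥ 1):
-- those below diagonal q + 3, and the one on it if its position is not taken by ∞.
RowKey : ℕ → ℕ → ℕ → ℕ → Set
RowKey q m i j = i + j ≤ q ⊎ (i + j ≡ suc q × m ≤ i)

rowKeys : ℕ → ℕ → ℕ → ℕ
rowKeys q m i = q ∸ i + 𝟙 (m ≤? i ×-dec i ≤? q)

private
  cell-sum : ∀ i j → suc (suc i) + suc j ≡ 3 + (i + j)
  cell-sum = solve-∀

keyCell⇒rowKey : ∀ {q m i j} → KeyCell (suc q) m (suc (suc i)) (suc j) → 1 ≤ j × RowKey q m i j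
keyCell⇒rowKey {q} {m} {i} {j} (_ , s≤s 1≤j , inj₁ below) =
  1≤j , inj₁ (≤-pred (≤-pred (≤-pred (subst₂ _≤_ (cell-sum i j) (+-comm (suc q) 2) below))))
keyCell⇒rowKey {q} {m} {i} {j} (_ , s≤s 1≤j , inj₂ (diagonal , short)) =
  1≤j , inj₂ (i+j≡1+q , +-cancelˡ-≤ j m i j+m≤j+i)
  where
  i+j≡1+q : i + j ≡ suc q
  i+j≡1+q = +-cancelˡ-≡ 3 _ _ (trans (sym (cell-sum i j)) (trans diagonal (+-comm (suc q) 3)))
  j+m≤j+i : j + m ≤ j + i
  j+m≤j+i = subst (j + m ≤_) (trans (sym i+j≡1+q) (+-comm i j))
              (≤-pred (≤-pred (subst (suc (suc (j + m)) ≤_) (+-comm (suc q) 2) short)))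

rowKey⇒keyCell : ∀ {q m i j} → 1 ≤ j → RowKey q m i j → KeyCell (suc q) m (suc (suc i)) (suc j)
rowKey⇒keyCell {q} {m} {i} {j} 1≤j (inj₁ i+j≤q) =
  s≤s (s≤s z≤n) , s≤s 1≤j ,
  inj₁ (subst₂ _≤_ (sym (cell-sum i j)) (+-comm 2 (suc q)) (s≤s (s≤s (s≤s i+j≤q))))
rowKey⇒keyCell {q} {m} {i} {j} 1≤j (inj₂ (i+j≡1+q , m≤i)) =
  s≤s (s≤s z≤n) , s≤s 1≤j ,
  inj₂ (trans (cell-sum i j) (trans (cong (3 +_) i+j≡1+q) (+-comm 3 (suc q))) ,
        subst (suc (suc (j + m)) ≤_) (+-comm 2 (suc q)) (s≤s (s≤s j+m≤1+q)))
  where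
  j+m≤1+q : j + m ≤ suc q
  j+m≤1+q = subst (j + m ≤_) (trans (+-comm j i) i+j≡1+q) (+-monoʳ-≤ j m≤i)

rowKeys-cases : ∀ q m i →
    (m ≤ i × i ≤ q × rowKeys q m i ≡ suc q ∸ i)
  ⊎ (¬ (m ≤ i × i ≤ q) × rowKeys q m i ≡ q ∸ i)
rowKeys-cases q m i with m ≤? i ×-dec i ≤? q
... | yes (m≤i , i≤q) =
  inj₁ (m≤i , i≤q , trans (sym (+-∸-comm 1 i≤q)) (cong (_∸ i) (+-comm q 1)))
... | no  ¬d          = inj₂ (¬d , +-identityʳ (q ∸ i))

rowKeys≤ : ∀ q m i → rowKeys q m i ≤ suc q ∸ i
rowKeys≤ q m i with rowKeys-cases q m i
... | inj₁ (_ , _ , k≡) = ≤-reflexive k≡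
... | inj₂ (_ , k≡)     = subst (_≤ suc q ∸ i) (sym k≡) (∸-monoˡ-≤ i (n≤1+n q))

rowKey⇒≤rowKeys : ∀ {q m i j} → 1 ≤ j → RowKey q m i j → j ≤ rowKeys q m i
rowKey⇒≤rowKeys {q} {m} {i} {j} 1≤j rk with rowKeys-cases q m i
... | inj₁ (_ , _ , k≡) = subst (j ≤_) (sym k≡) (+≤⇒≤∸ (onOrBelow rk))
  where
  onOrBelow : RowKey q m i j → i + j ≤ suc q
  onOrBelow (inj₁ i+j≤q)         = m≤n⇒m≤1+n i+j≤q
  onOrBelow (inj₂ (i+j≡1+q , _)) = ≤-reflexive i+j≡1+q
... | inj₂ (¬d , k≡) = subst (j ≤_) (sym k≡) (+≤⇒≤∸ (below rk))
  where
  below : RowKey q m i j → i + j ≤ q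
  below (inj₁ i+j≤q)           = i+j≤q
  below (inj₂ (i+j≡1+q , m≤i)) =
    contradiction (m≤i , s≤s⁻¹ (subst₂ _≤_ (+-comm i 1) i+j≡1+q (+-monoʳ-≤ i 1≤j))) ¬d

≤rowKeys⇒rowKey : ∀ {q m i j} → 1 ≤ j → j ≤ rowKeys q m i → RowKey q m i j
≤rowKeys⇒rowKey {q} {m} {i} {j} 1≤j j≤k with rowKeys-cases q m i
... | inj₂ (_ , k≡) = inj₁ (≤∸⇒+≤ 1≤j (subst (j ≤_) k≡ j≤k))
... | inj₁ (m≤i , _ , k≡) with m≤n⇒m<n∨m≡n (≤∸⇒+≤ 1≤j (subst (j ≤_) k≡ j≤k))
...   | inj₁ i+j<1+q = inj₁ (s≤s⁻¹ i+j<1+q)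
...   | inj₂ i+j≡1+q = inj₂ (i+j≡1+q , m≤i)

∑-keyCells-row : ∀ {q m i} → i < q + 3 →
  ∑ (q + 3 ∸ i) (λ j → 𝟙 (keyCell? (suc q) m (suc (suc i)) (suc j))) ≡ rowKeys q m i
∑-keyCells-row {q} {m} {i} i<q+3 =
  ∑-𝟙-interval (λ j → keyCell? (suc q) m (suc (suc i)) (suc j)) (q + 3 ∸ i) (s≤s z≤n)
    (≤-<-trans (rowKeys≤ q m i) (∸-monoˡ-<′ 1+q<q+3 i<q+3))
    (λ isKey → let 1≤j , rk = keyCell⇒rowKey isKey in 1≤j , s≤s (rowKey⇒≤rowKeys 1≤j rk))
    (λ 1≤j j<1+k → rowKey⇒keyCell 1≤j (≤rowKeys⇒rowKey 1≤j (s≤s⁻¹ j<1+k)))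
  where
  1+q<q+3 : suc q < q + 3
  1+q<q+3 = subst (suc q <_) (+-comm 3 q) (m≤n⇒m≤1+n (n<1+n (suc q)))

∑-keyCells : ∀ {q m} → m ≤ q →
  ∑ (suc q + 3) (λ i → ∑ (suc q + 3 ∸ i) (λ j → 𝟙 (keyCell? (suc q) m (suc i) (suc j))))
    ≡ triangle q + (suc q ∸ m)
∑-keyCells {q} {m} m≤q = begin
  ∑ (suc q + 3) (λ i → ∑ (suc q + 3 ∸ i) (λ j → 𝟙 (keyCell? (suc q) m (suc i) (suc j))))
    ≡⟨ cong₂ _+_ firstRow (∑-cong (q + 3) ∑-keyCells-row) ⟩
  ∑ (q + 3) (rowKeys q m)
    ≡⟨ ∑-distrib-+ (q + 3) (q ∸_) _ ⟩
  ∑ (q + 3) (q ∸_) + ∑ (q + 3) (λ i → 𝟙 (m ≤? i ×-dec i ≤? q))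
    ≡⟨ cong₂ _+_ (∑-∸≡triangle (m≤m+n q 3)) diagonal ⟩
  triangle q + (suc q ∸ m) ∎
  where
  open ≡-Reasoning
  firstRow : ∑ (suc q + 3) (λ j → 𝟙 (keyCell? (suc q) m 1 (suc j))) ≡ 0
  firstRow = trans
    (∑-cong (suc q + 3) (λ {j} _ → 𝟙-no (λ { (s≤s () , _) }) (keyCell? (suc q) m 1 (suc j))))
    (∑-zero (suc q + 3))
  diagonal : ∑ (q + 3) (λ i → 𝟙 (m ≤? i ×-dec i ≤? q)) ≡ suc q ∸ m
  diagonal = ∑-𝟙-interval (λ i → m ≤? i ×-dec i ≤? q) (q + 3) (m≤n⇒m≤1+n m≤q)
    (subst (suc q ≤_) (+-comm 3 q) (m≤n⇒m≤1+n (n≤1+n (suc q))))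
    (λ (m≤i , i≤q) → m≤i , s≤s i≤q) (λ m≤i i<1+q → m≤i , s≤s⁻¹ i<1+q)

module _ {h : ℕ} {f : Assignment} (lds : IsLDS h f) where
  open IsLDS lds

  nonKeyCell⇒zer⊎∞ : ∀ {r c} → InDiagram h r c → ¬ KeyCell h m r c →
                     f r c ≡ zer ⊎ f r c ≡ ∞
  nonKeyCell⇒zer⊎∞ {r} {c} d@(1≤r , 1≤c , r+c≤h+4) ¬key with r ≟ 1 | c ≟ 1
  ... | yes r≡1 | _       = inj₁ (border r c d (inj₁ r≡1))
  ... | no  _   | yes c≡1 = inj₁ (border r c d (inj₂ c≡1))
  ... | no  r≢1 | no  c≢1 =
    inj₂ (interior (≤+1⇒≤⊎≡+1 (subst (r + c ≤_) (sym (+-assoc h 3 1)) r+c≤h+4)))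
    where
    2≤r : 2 ≤ r
    2≤r = ≤∧≢⇒< 1≤r (r≢1 ∘ sym)
    2≤c : 2 ≤ c
    2≤c = ≤∧≢⇒< 1≤c (c≢1 ∘ sym)
    c≤h+1 : r + c ≡ h + 3 → c ≤ h + 1
    c≤h+1 r+c≡h+3 = +-cancelʳ-≤ 2 c (h + 1)
      (subst₂ _≤_ (+-comm 2 c) (trans r+c≡h+3 (sym (+-assoc h 1 2))) (+-monoˡ-≤ c 2≤r))
    interior : r + c ≤ h + 3 ⊎ r + c ≡ h + 3 + 1 → f r c ≡ ∞
    interior (inj₂ r+c≡h+4) = diagInf r c 2≤r 2≤c (trans r+c≡h+4 (+-assoc h 3 1))
    interior (inj₁ r+c≤h+3) with ≤+1⇒≤⊎≡+1 (subst (r + c ≤_) (sym (+-assoc h 2 1)) r+c≤h+3)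
    ... | inj₁ r+c≤h+2   = contradiction (2≤r , 2≤c , inj₁ r+c≤h+2) ¬key
    ... | inj₂ r+c≡h+2+1 = onDiagonal (trans r+c≡h+2+1 (+-assoc h 2 1))
      where
      onDiagonal : r + c ≡ h + 3 → f r c ≡ ∞
      onDiagonal r+c≡h+3 with c + m <? h + 2
      ... | yes short = contradiction (2≤r , 2≤c , inj₂ (r+c≡h+3 , short)) ¬key
      ... | no  long  = partInf r c 1≤r r+c≡h+3 (≮⇒≥ long) (c≤h+1 r+c≡h+3)

  isProperKey≡𝟙keyCell : ∀ {r c} → InDiagram h r c →
                         isProperKey (f r c) ≡ 𝟙 (keyCell? h m r c)
  isProperKey≡𝟙keyCell {r} {c} d with keyCell? h m r c
  ... | yes isKey with keys r c isKey
  ...   | suc _ , _ , f≡key = cong isProperKey f≡key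
  isProperKey≡𝟙keyCell {r} {c} d | no ¬key with nonKeyCell⇒zer⊎∞ d ¬key
  ... | inj₁ f≡zer = cong isProperKey f≡zer
  ... | inj₂ f≡∞   = cong isProperKey f≡∞

  numKeys-IsLDS : ∀ {q} → h ≡ suc q → numKeys h f ≡ triangle q + (suc q ∸ m)
  numKeys-IsLDS {q} refl = begin
    numKeys h f
      ≡⟨ numKeys≡∑∑ h f ⟩
    ∑ (h + 3) (λ i → ∑ (h + 3 ∸ i) (λ j → isProperKey (f (suc i) (suc j))))
      ≡⟨ ∑-cong (h + 3) (λ i< → ∑-cong _ (λ j< →
           isProperKey≡𝟙keyCell (inDiagram i< j<))) ⟩
    ∑ (h + 3) (λ i → ∑ (h + 3 ∸ i) (λ j → 𝟙 (keyCell? h m (suc i) (suc j))))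
      ≡⟨ ∑-keyCells (s≤s⁻¹ (subst (_≤ suc q) (+-comm m 1) m≤h-1)) ⟩
    triangle q + (suc q ∸ m) ∎
    where
    open ≡-Reasoning
    inDiagram : ∀ {i j} → i < h + 3 → j < h + 3 ∸ i → InDiagram h (suc i) (suc j)
    inDiagram {i} {j} i< j< = s≤s z≤n , s≤s z≤n ,
      subst (suc i + suc j ≤_) (sym (+-suc h 3))
        (s≤s (subst (_≤ h + 3) (+-comm (suc j) i) (m≤o∸n⇒m+n≤o (suc j) (<⇒≤ i<) j<)))

HasLDS⇒≤triangle : ∀ {h N} → HasLDS h N → N ≤ triangle h
HasLDS⇒≤triangle {zero}      (_ , lds , _) =
  contradiction (m+n≤o⇒n≤o (IsLDS.m lds) (IsLDS.m≤h-1 lds)) λ ()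
HasLDS⇒≤triangle {suc q} {N} (f , lds , numKeys≡N) = begin
  N                                   ≡⟨ numKeys≡N ⟨
  numKeys (suc q) f                   ≡⟨ numKeys-IsLDS lds refl ⟩
  triangle q + (suc q ∸ IsLDS.m lds)  ≤⟨ +-monoʳ-≤ (triangle q) (m∸n≤m (suc q) (IsLDS.m lds)) ⟩
  triangle q + suc q                  ≡⟨ +-comm (triangle q) (suc q) ⟩
  triangle (suc q)                    ∎
  where open ≤-Reasoning

-- A lattice data structure for every admissible number of keys

-- Labelling cells by diagonal, then by column, makes rows, columns and diagonals increase.
keyLabel : ℕ → ℕ → ℕ → ℕ
keyLabel h r c = c + (r + c) * suc (suc h)

canonical : ℕ → ℕ → Assignment
canonical h m r c =
  if does (keyCell? h m r c) then key (keyLabel h r c)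
  else if does (r ≤? 1 ⊎-dec c ≤? 1) then zer else ∞

keyCell⇒c<h+2 : ∀ {h m r c} → KeyCell h m r c → c < suc (suc h)
keyCell⇒c<h+2 {h} {m} {r} {c} (2≤r , _ , belowOrOn) =
  s≤s (+-cancelʳ-≤ 2 c (suc h) (begin
    c + 2   ≡⟨ +-comm c 2 ⟩
    2 + c   ≤⟨ +-monoˡ-≤ c 2≤r ⟩
    r + c   ≤⟨ r+c≤h+3 belowOrOn ⟩
    h + 3   ≡⟨ +-suc h 2 ⟩
    suc h + 2 ∎))
  where
  open ≤-Reasoning
  r+c≤h+3 : r + c ≤ h + 2 ⊎ (r + c ≡ h + 3 × c + m < h + 2) → r + c ≤ h + 3
  r+c≤h+3 (inj₁ below)   = ≤-trans below (+-monoʳ-≤ h (n≤1+n 2))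
  r+c≤h+3 (inj₂ (on , _)) = ≤-reflexive on

lastDiagonal⇒¬KeyCell : ∀ {h m r c} → r + c ≡ h + 4 → ¬ KeyCell h m r c
lastDiagonal⇒¬KeyCell {h} r+c≡h+4 (_ , _ , inj₁ below)
  with +-cancelˡ-≤ h 4 2 (subst (_≤ h + 2) r+c≡h+4 below)
... | s≤s (s≤s ())
lastDiagonal⇒¬KeyCell {h} r+c≡h+4 (_ , _ , inj₂ (on , _))
  with +-cancelˡ-≡ h 4 3 (trans (sym r+c≡h+4) on)
... | ()

module _ {h m : ℕ} where

  canonical-key : ∀ {r c} → KeyCell h m r c → canonical h m r c ≡ key (keyLabel h r c)
  canonical-key {r} {c} isKey rewrite dec-true (keyCell? h m r c) isKey = refl

  canonical-zer : ∀ {r c} → r ≤ 1 ⊎ c ≤ 1 → canonical h m r c ≡ zer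
  canonical-zer {r} {c} onBorder
    rewrite dec-false (keyCell? h m r c) (λ (2≤r , 2≤c , _) → [ <⇒≱ 2≤r , <⇒≱ 2≤c ] onBorder)
          | dec-true (r ≤? 1 ⊎-dec c ≤? 1) onBorder = refl

  canonical-∞ : ∀ {r c} → 2 ≤ r → 2 ≤ c → ¬ KeyCell h m r c → canonical h m r c ≡ ∞
  canonical-∞ {r} {c} 2≤r 2≤c ¬key
    rewrite dec-false (keyCell? h m r c) ¬key
          | dec-false (r ≤? 1 ⊎-dec c ≤? 1) [ <⇒≱ 2≤r , <⇒≱ 2≤c ] = refl

  canonical-label : ∀ {r c a} → KeyCell h m r c → canonical h m r c ≡ key a → a ≡ keyLabel h r c
  canonical-label isKey eq with refl ← trans (sym eq) (canonical-key isKey) = refl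

  canonical-partInf : m + 1 ≤ h → ∀ r c → 1 ≤ r → r + c ≡ h + 3 → h + 2 ≤ c + m → c ≤ h + 1 →
                      canonical h m r c ≡ ∞
  canonical-partInf m+1≤h r c _ r+c≡h+3 h+2≤c+m c≤h+1 = canonical-∞ 2≤r 2≤c notKey
    where
    2≤r : 2 ≤ r
    2≤r = +-cancelʳ-≤ (h + 1) 2 r (begin
      2 + (h + 1)  ≡⟨ rearrange h ⟩
      h + 3        ≡⟨ r+c≡h+3 ⟨
      r + c        ≤⟨ +-monoʳ-≤ r c≤h+1 ⟩
      r + (h + 1)  ∎)
      where
      open ≤-Reasoning
      rearrange : ∀ h → 2 + (h + 1) ≡ h + 3
      rearrange = solve-∀
    2≤c : 2 ≤ c
    2≤c = +-cancelʳ-≤ m 2 c (begin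
      2 + m   ≤⟨ s≤s (subst (_≤ h) (+-comm m 1) m+1≤h) ⟩
      suc h   ≤⟨ n≤1+n (suc h) ⟩
      2 + h   ≡⟨ +-comm 2 h ⟩
      h + 2   ≤⟨ h+2≤c+m ⟩
      c + m   ∎)
      where open ≤-Reasoning
    notKey : ¬ KeyCell h m r c
    notKey (_ , _ , inj₁ below) with +-cancelˡ-≤ h 3 2 (subst (_≤ h + 2) r+c≡h+3 below)
    ... | s≤s (s≤s ())
    notKey (_ , _ , inj₂ (_ , short)) = <⇒≱ short h+2≤c+m

  canonical-distinct : ∀ r c r′ c′ → KeyCell h m r c → KeyCell h m r′ c′ →
                       canonical h m r c ≡ canonical h m r′ c′ → r ≡ r′ × c ≡ c′
  canonical-distinct r c r′ c′ k k′ same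
    with c≡c′ , r+c≡r′+c′ ← remainder-quotient-injective (keyCell⇒c<h+2 k) (keyCell⇒c<h+2 k′)
                               (canonical-label k′ (trans (sym same) (canonical-key k)))
    = +-cancelʳ-≡ c r r′ (subst (λ x → r + c ≡ r′ + x) (sym c≡c′) r+c≡r′+c′) , c≡c′

  canonical-ordered : ∀ {r c r′ c′ a b} → KeyCell h m r c → KeyCell h m r′ c′ →
                      canonical h m r c ≡ key a → canonical h m r′ c′ ≡ key b →
                      keyLabel h r c < keyLabel h r′ c′ → a < b
  canonical-ordered k k′ ea eb = subst₂ _<_ (sym (canonical-label k ea)) (sym (canonical-label k′ eb))

canonical-IsLDS : ∀ {h m} → m + 1 ≤ h → IsLDS h (canonical h m)
canonical-IsLDS {h} {m} m+1≤h = record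
  { border   = λ _ _ _ onBorder → canonical-zer (Data.Sum.map ≤-reflexive ≤-reflexive onBorder)
  ; diagInf  = λ _ _ 2≤r 2≤c r+c≡h+4 → canonical-∞ 2≤r 2≤c (lastDiagonal⇒¬KeyCell r+c≡h+4)
  ; m        = m
  ; m≤h-1    = m+1≤h
  ; partInf  = canonical-partInf m+1≤h
  ; keys     = λ r c isKey@(_ , 2≤c , _) →
                 keyLabel h r c , ≤-trans (<⇒≤ 2≤c) (m≤m+n c _) , canonical-key isKey
  ; distinct = canonical-distinct
  ; rowInc   = λ r c c′ a b k k′ ea eb c<c′ → canonical-ordered k k′ ea eb
                 (+-mono-<-≤ c<c′ (*-monoˡ-≤ K (+-monoʳ-≤ r (<⇒≤ c<c′))))
  ; colInc   = λ r r′ c a b k k′ ea eb r<r′ → canonical-ordered k k′ ea eb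
                 (+-monoʳ-< c (*-monoˡ-< K (+-monoˡ-< c r<r′)))
  ; diagInc  = λ r c r′ c′ a b k k′ r+c≡r′+c′ ea eb c<c′ → canonical-ordered k k′ ea eb
                 (subst (λ s → c + s * K < c′ + (r′ + c′) * K) (sym r+c≡r′+c′) (+-monoˡ-< _ c<c′))
  }
  where
  K : ℕ
  K = suc (suc h)

hasLDS : ∀ {p N} → triangle p < N → N ≤ triangle (suc p) → HasLDS (suc p) N
hasLDS {p} {N} tp<N N≤tp+1 = canonical (suc p) m , lds , (begin
  numKeys (suc p) (canonical (suc p) m)  ≡⟨ numKeys-IsLDS lds refl ⟩
  triangle p + (suc p ∸ m)               ≡⟨ cong (triangle p +_) (m∸[m∸n]≡n d≤1+p) ⟩
  triangle p + d                         ≡⟨ m+[n∸m]≡n (<⇒≤ tp<N) ⟩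
  N                                      ∎)
  where
  open ≡-Reasoning
  d : ℕ
  d = N ∸ triangle p
  d≤1+p : d ≤ suc p
  d≤1+p = m≤n+o⇒m∸n≤o N (triangle p) (subst (N ≤_) (+-comm (suc p) (triangle p)) N≤tp+1)
  m : ℕ
  m = suc p ∸ d
  lds : IsLDS (suc p) (canonical (suc p) m)
  lds = canonical-IsLDS (subst (_≤ suc p) (+-comm 1 m) (∸-monoʳ-< (m<n⇒0<n∸m tp<N) d≤1+p))

corollary1 : ∀ (N : ℕ) → 1 ≤ N →
    ∀ (s : ℕ) → s * s ≤ 8 * N ∸ 7 → 8 * N ∸ 7 < suc s * suc s →
    (1 ≤ (1 + s) / 2 × HasLDS ((1 + s) / 2) N)
    × (∀ h → 1 ≤ h → HasLDS h N → (1 + s) / 2 ≤ h)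
    × (8 * N + 1 ≤ (2 * ((1 + s) / 2) + 1) * (2 * ((1 + s) / 2) + 1))
    × (∀ k → 8 * N + 1 ≤ (2 * k + 1) * (2 * k + 1) → (1 + s) / 2 ≤ k)
corollary1 (suc n) _ s lo hi
  with (1 + s) / 2 | isqrt-triangle-bracket {n} {s} (subst (s * s ≤_) (8[1+n]∸7≡8n+1 n) lo)
                                                   (subst (_< suc s * suc s) (8[1+n]∸7≡8n+1 n) hi)
... | _ | p , refl , tp≤n , n<tp+1 =
  (s≤s z≤n , hasLDS (s≤s tp≤n) n<tp+1) ,
  (λ _ _ has → triangle-cancel-< (<-≤-trans (s≤s tp≤n) (HasLDS⇒≤triangle has))) ,
  ≤triangle⇒≤odd-square {k = suc p} n<tp+1 ,
  (λ k le → triangle-cancel-< (<-≤-trans (s≤s tp≤n) (≤odd-square⇒≤triangle {k = k} le)))
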